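{- There exists an infinite, recurrent, aperiodic binary word $w$ which is not closed under reversal, which contains infinitely many distinct palindromic factors, and whose set of palindromic factors is a proper subset of its set of privileged factors.
   Context: An infinite word is recurrent if each factor occurs infinitely often; it is aperiodic if it is not of the form $uvvv\cdots$ with $v$ nonempty. A word is closed under reversal if the reversal of each of its factors is also a factor. A palindrome is a word equal to its reversal. A complete first return to a word $v$ is a word that begins with $v$, ends with $v$, and contains exactly two occurrences of $v$. Privileged words: the empty word and every letter are privileged, and a word is privileged if it is a complete first return to a shorter privileged word. -}

module Defs where

open import Data.Bool using (Bool; true; false; _∧_; if_then_else_)
open import Data.Nat using (ℕ; zero; suc; _+_; _<_; _≤_)
open import Data.List using (List; []; _∷_; length; reverse; _++_)
open import Data.Product using (∃-syntax; _×_)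
open import Relation.Nullary using (¬_)
open import Relation.Binary.PropositionalEquality using (_≡_)

Word : Set
Word = ℕ → Bool

slice : Word → ℕ → ℕ → List Bool
slice w i zero    = []
slice w i (suc n) = w i ∷ slice w (suc i) n

OccursAt : Word → List Bool → ℕ → Set
OccursAt w u i = slice w i (length u) ≡ u

Factor : Word → List Bool → Set
Factor w u = ∃[ i ] OccursAt w u i

Recurrent : Word → Set
Recurrent w = (u : List Bool) → Factor w u → (N : ℕ) → ∃[ i ] (N ≤ i × OccursAt w u i)

UltimatelyPeriodic : Word → Set
UltimatelyPeriodic w = ∃[ p ] ∃[ N ] (0 < p × ((i : ℕ) → N ≤ i → w (i + p) ≡ w i))

Aperiodic : Word → Set
Aperiodic w = ¬ UltimatelyPeriodic w

ClosedUnderReversal : Word → Set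
ClosedUnderReversal w = (u : List Bool) → Factor w u → Factor w (reverse u)

Palindrome : List Bool → Set
Palindrome u = reverse u ≡ u

IsPrefix : List Bool → List Bool → Set
IsPrefix v u = ∃[ s ] (v ++ s ≡ u)

IsSuffix : List Bool → List Bool → Set
IsSuffix v u = ∃[ s ] (s ++ v ≡ u)

isPrefixᵇ : List Bool → List Bool → Bool
isPrefixᵇ []      u       = true
isPrefixᵇ (a ∷ v) []      = false
isPrefixᵇ (a ∷ v) (b ∷ u) = (a == b) ∧ isPrefixᵇ v u
  where
  _==_ : Bool → Bool → Bool
  false == false = true
  true  == true  = true
  _     == _     = false

-- Number of positions at which v occurs in u (as a factor), counting
-- also the empty suffix position.
countOcc : List Bool → List Bool → ℕ
countOcc v []      = if isPrefixᵇ v [] then 1 else 0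
countOcc v (a ∷ u) = (if isPrefixᵇ v (a ∷ u) then 1 else 0) + countOcc v u

CompleteFirstReturn : List Bool → List Bool → Set
CompleteFirstReturn u v = IsPrefix v u × IsSuffix v u × countOcc v u ≡ 2

data Privileged : List Bool → Set where
  priv-empty  : Privileged []
  priv-letter : (a : Bool) → Privileged (a ∷ [])
  priv-return : (u v : List Bool) → length v < length u →
                Privileged v → CompleteFirstReturn u v → Privileged u

module Submission where

-- The word w consists of runs of alternating letters 0, 1, 0, 1, ..., where runs 2k and 2k + 1
-- both have length 1 + ν(k), ν being the ruler function (the number of trailing 1 bits of k).
-- Since ν(k) ≠ ν(k + 1), three consecutive runs never have the shape c^a d^b c^a, so w contains
-- no factor d c^a d^b c^a d.  A palindrome without such a factor is c^n or c^a d^b c^a, a complete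
-- first return to c^(n-1) resp. c^a, hence privileged; the palindromes 0^n are unbounded.
-- Runs 2k and 2k + 1 have equal length, so w contains 01001 but not 10010, and 00110100 is a
-- privileged non-palindrome.  Recurrence comes from ν(x + 2^M) = ν(x) for x < 2^M - 1, which
-- makes every prefix of w reappear arbitrarily far out.  Aperiodicity: every run length p occurs
-- arbitrarily far out, and a full run of length p shows that p is not an eventual period.

open import Defs
open import Data.Bool using (Bool; true; false; not; if_then_else_)
open import Data.Bool.Properties using (not-involutive; not-¬; ∧-zeroʳ)
open import Data.Empty using (⊥; ⊥-elim)
open import Data.List using (List; []; _∷_; length; map; reverse; _++_; replicate; _∷ʳ_; initLast; _∷ʳ′_)
open import Data.List.Membership.Propositional using (_∈_)
open import Data.List.Properties
  using ( length-replicate; length-++; ∷-injective; ∷-injectiveˡ; ∷-injectiveʳ; ∷ʳ-injective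
        ; ++-assoc; ++-identityʳ; unfold-reverse; reverse-++ )
open import Data.List.Relation.Unary.Any using (here; there)
open import Data.Nat using (ℕ; zero; suc; _+_; _*_; _^_; _≤_; _<_; z≤n; s≤s; ⌊_/2⌋)
open import Data.Nat.Binary using (ℕᵇ; zero; 2[1+_]; 1+[2_]; double; fromℕ; toℕ)
open import Data.Nat.Binary.Properties using (fromℕ-toℕ; toℕ-fromℕ; toℕ-double)
open import Data.Nat.ListAction using (sum)
open import Data.Nat.Properties
open import Algebra.Properties.CommutativeSemigroup +-commutativeSemigroup using (interchange)
open import Data.Product using (∃-syntax; _×_; _,_; proj₁; proj₂)
open import Data.Sum using (_⊎_; inj₁; inj₂)
open import Function using (_∘_)
open import Relation.Binary.Definitions using (tri<; tri≈; tri>)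
open import Relation.Binary.PropositionalEquality
open import Relation.Nullary using (¬_; does; yes; no)
open import Relation.Nullary.Decidable using (dec-true; dec-false)

true≢false : true ≢ false
true≢false ()

isOdd : ℕ → Bool
isOdd zero    = false
isOdd (suc n) = not (isOdd n)

isOdd-double : ∀ k → isOdd (k + k) ≡ false
isOdd-double zero    = refl
isOdd-double (suc k) rewrite +-suc k k | not-involutive (isOdd (k + k)) = isOdd-double k

isOdd-+-even : ∀ m {n} → isOdd n ≡ false → isOdd (m + n) ≡ isOdd m
isOdd-+-even zero    n-even = n-even
isOdd-+-even (suc m) n-even = cong not (isOdd-+-even m n-even)

even-or-odd : ∀ n → (∃[ k ] n ≡ k + k) ⊎ (∃[ k ] n ≡ suc (k + k))
even-or-odd zero = inj₁ (0 , refl)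
even-or-odd (suc n) with even-or-odd n
... | inj₁ (k , refl) = inj₂ (k , refl)
... | inj₂ (k , refl) = inj₁ (suc k , cong suc (sym (+-suc k k)))

⌊+double/2⌋ : ∀ m n → ⌊ m + (n + n) /2⌋ ≡ ⌊ m /2⌋ + n
⌊+double/2⌋ zero          n = sym (n≡⌊n+n/2⌋ n)
⌊+double/2⌋ (suc zero)    n = sym (n≡⌈n+n/2⌉ n)
⌊+double/2⌋ (suc (suc m)) n = cong suc (⌊+double/2⌋ m n)

2^suc : ∀ M → 2 ^ suc M ≡ 2 ^ M + 2 ^ M
2^suc M = cong (2 ^ M +_) (+-identityʳ (2 ^ M))

n<2^n : ∀ n → n < 2 ^ n
n<2^n zero    = s≤s z≤n
n<2^n (suc n) = subst (suc n <_) (sym (2^suc n)) (≤-<-trans (n<2^n n) (m<m+n (2 ^ n) (m^n>0 2 n)))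

half-< : ∀ k P → suc (suc (k + k)) < P + P → suc k < P
half-< k P h = ≰⇒> λ P≤1+k →
  <⇒≱ h (≤-trans (+-mono-≤ P≤1+k P≤1+k) (≤-reflexive (cong suc (+-suc k k))))

-- ruler n is the number of trailing 1 bits of n, i.e. the 2-adic valuation of n + 1.
trailingOnes : ℕᵇ → ℕ
trailingOnes 1+[2 x ] = suc (trailingOnes x)
trailingOnes _        = 0

ruler : ℕ → ℕ
ruler n = trailingOnes (fromℕ n)

twice-toℕ-fromℕ : ∀ k → 2 * toℕ (fromℕ k) ≡ k + k
twice-toℕ-fromℕ k = trans (cong (2 *_) (toℕ-fromℕ k)) (cong (k +_) (+-identityʳ k))

fromℕ-double : ∀ k → fromℕ (k + k) ≡ double (fromℕ k)
fromℕ-double k =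
  trans (cong fromℕ (sym (trans (toℕ-double (fromℕ k)) (twice-toℕ-fromℕ k)))) (fromℕ-toℕ _)

fromℕ-1+double : ∀ k → fromℕ (suc (k + k)) ≡ 1+[2 fromℕ k ]
fromℕ-1+double k = trans (cong (fromℕ ∘ suc) (sym (twice-toℕ-fromℕ k))) (fromℕ-toℕ 1+[2 fromℕ k ])

trailingOnes-double : ∀ x → trailingOnes (double x) ≡ 0
trailingOnes-double zero     = refl
trailingOnes-double 2[1+ x ] = refl
trailingOnes-double 1+[2 x ] = refl

ruler-even : ∀ k → ruler (k + k) ≡ 0
ruler-even k = trans (cong trailingOnes (fromℕ-double k)) (trailingOnes-double (fromℕ k))

ruler-odd : ∀ k → ruler (suc (k + k)) ≡ suc (ruler k)
ruler-odd k = cong trailingOnes (fromℕ-1+double k)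

ruler-suc-≢ : ∀ n → ruler n ≢ ruler (suc n)
ruler-suc-≢ n with even-or-odd n
... | inj₁ (k , refl) = λ eq → 0≢1+n (trans (sym (ruler-even k)) (trans eq (ruler-odd k)))
... | inj₂ (k , refl) = λ eq → 0≢1+n (trans (sym next-even) (trans (sym eq) (ruler-odd k)))
  where
  next-even : ruler (suc (suc (k + k))) ≡ 0
  next-even = trans (cong (ruler ∘ suc) (sym (+-suc k k))) (ruler-even (suc k))

ruler-periodic : ∀ M x → suc x < 2 ^ M → ruler (x + 2 ^ M) ≡ ruler x
ruler-periodic zero    x (s≤s ())
ruler-periodic (suc M) x h rewrite 2^suc M with even-or-odd x
... | inj₁ (k , refl) rewrite interchange k k (2 ^ M) (2 ^ M) | ruler-even (k + 2 ^ M) | ruler-even k = refl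
... | inj₂ (k , refl) rewrite interchange k k (2 ^ M) (2 ^ M) | ruler-odd (k + 2 ^ M) | ruler-odd k =
  cong suc (ruler-periodic M k (half-< k (2 ^ M) h))

ruler-attains : ∀ p N → ∃[ x ] N ≤ x × ruler x ≡ p
ruler-attains zero    N = N + N , m≤m+n N N , ruler-even N
ruler-attains (suc p) N with ruler-attains p N
... | x , N≤x , rx =
  suc (x + x) , ≤-trans N≤x (m≤n⇒m≤1+n (m≤m+n x x)) , trans (ruler-odd x) (cong suc rx)

replicate-∷ʳ : ∀ {A : Set} n (c : A) → replicate n c ∷ʳ c ≡ c ∷ replicate n c
replicate-∷ʳ zero    c = refl
replicate-∷ʳ (suc n) c = cong (c ∷_) (replicate-∷ʳ n c)

reverse-replicate : ∀ {A : Set} n (c : A) → reverse (replicate n c) ≡ replicate n c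
reverse-replicate zero    c = refl
reverse-replicate (suc n) c rewrite unfold-reverse c (replicate n c) | reverse-replicate n c = replicate-∷ʳ n c

length-<-++-∷ : ∀ {A : Set} (v : List A) b t → length v < length (v ++ (b ∷ t))
length-<-++-∷ []      b t = s≤s z≤n
length-<-++-∷ (a ∷ v) b t = s≤s (length-<-++-∷ v b t)

∈⇒length≤ : ∀ {A : Set} {u : List A} L → u ∈ L → length u ≤ sum (map length L)
∈⇒length≤ (x ∷ L) (here refl) = m≤m+n (length x) _
∈⇒length≤ (x ∷ L) (there u∈L) = ≤-trans (∈⇒length≤ L u∈L) (m≤n+m _ (length x))

module _ (v : Word) where

  occursAt-head : ∀ {a u i} → OccursAt v (a ∷ u) i → v i ≡ a
  occursAt-head = ∷-injectiveˡ

  occursAt-tail : ∀ {a u i} → OccursAt v (a ∷ u) i → OccursAt v u (suc i)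
  occursAt-tail = ∷-injectiveʳ

  occursAt-++⁻ : ∀ x y {i} → OccursAt v (x ++ y) i → OccursAt v x i × OccursAt v y (i + length x)
  occursAt-++⁻ []      y {i} occ rewrite +-identityʳ i = refl , occ
  occursAt-++⁻ (a ∷ x) y {i} occ with occursAt-++⁻ x y (occursAt-tail occ)
  ... | occ-x , occ-y =
    cong₂ _∷_ (occursAt-head occ) occ-x , subst (OccursAt v y) (sym (+-suc i (length x))) occ-y

  occursAt-infix : ∀ x y z {i} → OccursAt v (x ++ (y ++ z)) i → OccursAt v y (i + length x)
  occursAt-infix x y z occ = proj₁ (occursAt-++⁻ y z (proj₂ (occursAt-++⁻ x (y ++ z) occ)))

  occursAt-replicate⁻ : ∀ n c {i} → OccursAt v (replicate n c) i → ∀ t → t < n → v (i + t) ≡ c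
  occursAt-replicate⁻ (suc n) c {i} occ zero    _ rewrite +-identityʳ i = occursAt-head occ
  occursAt-replicate⁻ (suc n) c {i} occ (suc t) (s≤s t<n) rewrite +-suc i t =
    occursAt-replicate⁻ n c (occursAt-tail occ) t t<n

  slice-cong : ∀ n {i j} → (∀ t → t < n → v (i + t) ≡ v (j + t)) → slice v i n ≡ slice v j n
  slice-cong zero    agree = refl
  slice-cong (suc n) {i} {j} agree = cong₂ _∷_
    (subst₂ (λ x y → v x ≡ v y) (+-identityʳ i) (+-identityʳ j) (agree 0 (s≤s z≤n)))
    (slice-cong n λ t t<n → subst₂ (λ x y → v x ≡ v y) (+-suc i t) (+-suc j t) (agree (suc t) (s≤s t<n)))

  slice-const : ∀ n c {i} → (∀ t → t < n → v (i + t) ≡ c) → slice v i n ≡ replicate n c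
  slice-const zero    c const = refl
  slice-const (suc n) c {i} const = cong₂ _∷_
    (subst (λ x → v x ≡ c) (+-identityʳ i) (const 0 (s≤s z≤n)))
    (slice-const n c λ t t<n → subst (λ x → v x ≡ c) (+-suc i t) (const (suc t) (s≤s t<n)))

  occursAt-replicate⁺ : ∀ n c {i} → (∀ t → t < n → v (i + t) ≡ c) → OccursAt v (replicate n c) i
  occursAt-replicate⁺ n c const = trans (cong (slice v _) (length-replicate n)) (slice-const n c const)

  prefixes-recur⇒recurrent : (∀ n N → ∃[ s ] N ≤ s × (∀ i → i < n → v (s + i) ≡ v i)) → Recurrent v
  prefixes-recur⇒recurrent recur u (i , occ) N with recur (i + length u) N
  ... | s , N≤s , agree = s + i , ≤-trans N≤s (m≤m+n s i) , trans (slice-cong (length u) shifted) occ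
    where
    shifted : ∀ t → t < length u → v (s + i + t) ≡ v (i + t)
    shifted t t<len = trans (cong v (+-assoc s i t)) (agree (i + t) (+-monoʳ-< i t<len))

isPrefixᵇ-long : ∀ v u → length u < length v → isPrefixᵇ v u ≡ false
isPrefixᵇ-long (b ∷ v) []      _         = refl
isPrefixᵇ-long (b ∷ v) (a ∷ u) (s≤s u<v) rewrite isPrefixᵇ-long v u u<v = ∧-zeroʳ _

isPrefixᵇ-++ : ∀ v t → isPrefixᵇ v (v ++ t) ≡ true
isPrefixᵇ-++ []          t = refl
isPrefixᵇ-++ (false ∷ v) t = isPrefixᵇ-++ v t
isPrefixᵇ-++ (true  ∷ v) t = isPrefixᵇ-++ v t

isPrefixᵇ-refl : ∀ v → isPrefixᵇ v v ≡ true
isPrefixᵇ-refl v = subst (λ u → isPrefixᵇ v u ≡ true) (++-identityʳ v) (isPrefixᵇ-++ v [])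

isPrefixᵇ-mismatch : ∀ c v t → isPrefixᵇ (c ∷ v) (not c ∷ t) ≡ false
isPrefixᵇ-mismatch false v t = refl
isPrefixᵇ-mismatch true  v t = refl

isPrefixᵇ-short-run : ∀ j k c t → j ≤ k →
                      isPrefixᵇ (replicate (suc k) c) (replicate j c ++ (not c ∷ t)) ≡ false
isPrefixᵇ-short-run zero    k       c     t _         = isPrefixᵇ-mismatch c (replicate k c) t
isPrefixᵇ-short-run (suc j) (suc k) false t (s≤s j≤k) = isPrefixᵇ-short-run j k false t j≤k
isPrefixᵇ-short-run (suc j) (suc k) true  t (s≤s j≤k) = isPrefixᵇ-short-run j k true t j≤k

countOcc-short : ∀ v u → length u < length v → countOcc v u ≡ 0
countOcc-short (b ∷ v) []      _   = refl
countOcc-short v       (a ∷ u) u<v rewrite isPrefixᵇ-long v (a ∷ u) u<v =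
  countOcc-short v u (<-trans (n<1+n _) u<v)

countOcc-skip-short-run : ∀ j k c t → j ≤ k →
  countOcc (replicate (suc k) c) (replicate j c ++ (not c ∷ t)) ≡ countOcc (replicate (suc k) c) t
countOcc-skip-short-run zero    k c t j≤k rewrite isPrefixᵇ-short-run zero k c t j≤k = refl
countOcc-skip-short-run (suc j) k c t j≤k rewrite isPrefixᵇ-short-run (suc j) k c t j≤k =
  countOcc-skip-short-run j k c t (<⇒≤ j≤k)

countOcc-skip-mismatch : ∀ m c v t → countOcc (c ∷ v) (replicate m (not c) ++ t) ≡ countOcc (c ∷ v) t
countOcc-skip-mismatch zero    c v t = refl
countOcc-skip-mismatch (suc m) c v t rewrite isPrefixᵇ-mismatch c v (replicate m (not c) ++ t) =
  countOcc-skip-mismatch m c v t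

replicate-privileged : ∀ n c → Privileged (replicate n c)
replicate-privileged zero          c = priv-empty
replicate-privileged (suc zero)    c = priv-letter c
replicate-privileged (suc (suc n)) c =
  priv-return _ v (n<1+n _) (replicate-privileged (suc n) c)
    ((c ∷ [] , replicate-∷ʳ (suc n) c) , (c ∷ [] , refl) , twice)
  where
  v = replicate (suc n) c
  twice : countOcc v (c ∷ v) ≡ 2
  twice rewrite subst (λ u → isPrefixᵇ v u ≡ true) (replicate-∷ʳ (suc n) c) (isPrefixᵇ-++ v (c ∷ []))
              | isPrefixᵇ-refl v | countOcc-short v (replicate n c) ≤-refl = refl

threeRuns : Bool → ℕ → ℕ → List Bool
threeRuns c k m = replicate (suc k) c ++ (replicate (suc m) (not c) ++ replicate (suc k) c)

threeRuns-privileged : ∀ c k m → Privileged (threeRuns c k m)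
threeRuns-privileged c k m =
  priv-return _ v (length-<-++-∷ v (not c) _) (replicate-privileged (suc k) c)
    ((replicate (suc m) (not c) ++ v , refl) , (v ++ replicate (suc m) (not c) , ++-assoc v _ v) , twice)
  where
  v = replicate (suc k) c
  twice : countOcc v (threeRuns c k m) ≡ 2
  twice rewrite isPrefixᵇ-++ v (replicate (suc m) (not c) ++ v)
              | countOcc-skip-short-run k k c (replicate m (not c) ++ v) ≤-refl
              | countOcc-skip-mismatch m c (replicate k c) v
              | isPrefixᵇ-refl v | countOcc-short v (replicate k c) ≤-refl = refl

-- Palindromes without sandwiches

sandwich : Bool → ℕ → ℕ → List Bool
sandwich c k m = not c ∷ (threeRuns c k m ∷ʳ not c)

SandwichFree : List Bool → Set
SandwichFree u = ∀ x y c k m → x ++ (sandwich c k m ++ y) ≡ u → ⊥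

AtMostThreeRuns : List Bool → Set
AtMostThreeRuns u = (∃[ n ] ∃[ c ] u ≡ replicate n c) ⊎ (∃[ c ] ∃[ k ] ∃[ m ] u ≡ threeRuns c k m)

atMostThreeRuns-privileged : ∀ u → AtMostThreeRuns u → Privileged u
atMostThreeRuns-privileged _ (inj₁ (n , c , refl))     = replicate-privileged n c
atMostThreeRuns-privileged _ (inj₂ (c , k , m , refl)) = threeRuns-privileged c k m

sandwichFree-inner : ∀ a v → SandwichFree (a ∷ (v ∷ʳ a)) → SandwichFree v
sandwichFree-inner a v free x y c k m refl = free (a ∷ x) (y ∷ʳ a) c k m
  (cong (a ∷_) (sym (trans (++-assoc x _ (a ∷ [])) (cong (x ++_) (++-assoc (sandwich c k m) y (a ∷ []))))))

threeRuns-extend : ∀ c k m → c ∷ (threeRuns c k m ∷ʳ c) ≡ threeRuns c (suc k) m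
threeRuns-extend c k m = cong (c ∷_) (begin
  (A ++ (B ++ A)) ∷ʳ c ≡⟨ ++-assoc A (B ++ A) (c ∷ []) ⟩
  A ++ ((B ++ A) ∷ʳ c) ≡⟨ cong (A ++_) (++-assoc B A (c ∷ [])) ⟩
  A ++ (B ++ (A ∷ʳ c)) ≡⟨ cong (λ z → A ++ (B ++ z)) (replicate-∷ʳ (suc k) c) ⟩
  A ++ (B ++ (c ∷ A))  ∎)
  where
  open ≡-Reasoning
  A = replicate (suc k) c
  B = replicate (suc m) (not c)

atMostThreeRuns-extend : ∀ a v → AtMostThreeRuns v → SandwichFree (a ∷ (v ∷ʳ a)) →
                         AtMostThreeRuns (a ∷ (v ∷ʳ a))
atMostThreeRuns-extend false _ (inj₁ (n , false , refl)) _ =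
  inj₁ (suc (suc n) , false , cong (false ∷_) (replicate-∷ʳ n false))
atMostThreeRuns-extend true  _ (inj₁ (n , true  , refl)) _ =
  inj₁ (suc (suc n) , true , cong (true ∷_) (replicate-∷ʳ n true))
atMostThreeRuns-extend false _ (inj₁ (zero  , true  , refl)) _ = inj₁ (2 , false , refl)
atMostThreeRuns-extend true  _ (inj₁ (zero  , false , refl)) _ = inj₁ (2 , true  , refl)
atMostThreeRuns-extend false _ (inj₁ (suc n , true  , refl)) _ = inj₂ (false , 0 , n , refl)
atMostThreeRuns-extend true  _ (inj₁ (suc n , false , refl)) _ = inj₂ (true  , 0 , n , refl)
atMostThreeRuns-extend false _ (inj₂ (false , k , m , refl)) _ =
  inj₂ (false , suc k , m , threeRuns-extend false k m)
atMostThreeRuns-extend true  _ (inj₂ (true  , k , m , refl)) _ =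
  inj₂ (true , suc k , m , threeRuns-extend true k m)
atMostThreeRuns-extend false _ (inj₂ (true  , k , m , refl)) free = ⊥-elim (free [] [] true  k m (++-identityʳ _))
atMostThreeRuns-extend true  _ (inj₂ (false , k , m , refl)) free = ⊥-elim (free [] [] false k m (++-identityʳ _))

palindrome-∷ʳ⁻ : ∀ a v z → Palindrome (a ∷ (v ∷ʳ z)) → z ≡ a × Palindrome v
palindrome-∷ʳ⁻ a v z pal with ∷-injective (trans (sym reversed) pal)
  where
  reversed : reverse (a ∷ (v ∷ʳ z)) ≡ z ∷ (reverse v ∷ʳ a)
  reversed rewrite unfold-reverse a (v ∷ʳ z) | reverse-++ v (z ∷ []) = refl
... | z≡a , inner = z≡a , proj₁ (∷ʳ-injective (reverse v) v inner)

sandwichFree-palindrome : ∀ n u → length u ≤ n → Palindrome u → SandwichFree u → AtMostThreeRuns u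
sandwichFree-palindrome _ []       _   _   _    = inj₁ (0 , false , refl)
sandwichFree-palindrome n (a ∷ xs) len pal free with initLast xs
... | []      = inj₁ (1 , a , refl)
... | v ∷ʳ′ z with n | len | palindrome-∷ʳ⁻ a v z pal
...   | suc n′ | s≤s len′ | refl , inner =
  atMostThreeRuns-extend a v (sandwichFree-palindrome n′ v |v|≤n′ inner (sandwichFree-inner a v free)) free
  where
  |v|≤n′ : length v ≤ n′
  |v|≤n′ = m+n≤o⇒m≤o (length v) (≤-trans (≤-reflexive (sym (length-++ v))) len′)

palindromic-factors-privileged : ∀ (v : Word) → (∀ i c k m → ¬ OccursAt v (sandwich c k m) i) →
                                 (u : List Bool) → Factor v u → Palindrome u → Privileged u
palindromic-factors-privileged v no-sandwich u (i , occ) pal =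
  atMostThreeRuns-privileged u (sandwichFree-palindrome (length u) u ≤-refl pal free)
  where
  free : SandwichFree u
  free x y c k m refl = no-sandwich (i + length x) c k m (occursAt-infix v x (sandwich c k m) y occ)

-- Words given by their run lengths

-- The binary word whose j-th run (counting from 0) consists of suc (r j) copies of isOdd j.
module RunWord (r : ℕ → ℕ) where

  start : ℕ → ℕ
  start zero    = 0
  start (suc j) = start j + suc (r j)

  -- locate i = (j , t) when position i is at offset t in run j.
  next : ℕ × ℕ → ℕ × ℕ
  next (j , t) = if does (t <? r j) then (j , suc t) else (suc j , 0)

  locate : ℕ → ℕ × ℕ
  locate zero    = 0 , 0
  locate (suc i) = next (locate i)

  runWord : Word
  runWord i = isOdd (proj₁ (locate i))

  locate-start : ∀ j t → t ≤ r j → locate (start j + t) ≡ (j , t)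
  locate-start zero    zero    _ = refl
  locate-start j       (suc t) t<r
    rewrite +-suc (start j) t | locate-start j t (<⇒≤ t<r) | dec-true (t <? r j) t<r = refl
  locate-start (suc j) zero    _
    rewrite +-identityʳ (start j + suc (r j)) | +-suc (start j) (r j)
          | locate-start j (r j) ≤-refl | dec-false (r j <? r j) (<-irrefl refl) = refl

  runWord-run : ∀ j t → t ≤ r j → runWord (start j + t) ≡ isOdd j
  runWord-run j t t≤r = cong (isOdd ∘ proj₁) (locate-start j t t≤r)

  runWord-start : ∀ j → runWord (start j) ≡ isOdd j
  runWord-start j = trans (cong runWord (sym (+-identityʳ (start j)))) (runWord-run j 0 z≤n)

  position-in-run : ∀ i → ∃[ j ] ∃[ t ] t ≤ r j × i ≡ start j + t
  position-in-run zero = 0 , 0 , z≤n , refl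
  position-in-run (suc i) with position-in-run i
  ... | j , t , t≤r , refl with t <? r j
  ...   | yes t<r = j , suc t , t<r , sym (+-suc (start j) t)
  ...   | no  t≮r rewrite ≤-antisym t≤r (≮⇒≥ t≮r) =
    suc j , 0 , z≤n , trans (sym (+-suc (start j) (r j))) (sym (+-identityʳ _))

  j≤start : ∀ j → j ≤ start j
  j≤start zero    = z≤n
  j≤start (suc j) = subst (suc j ≤_) (sym (+-suc (start j) (r j))) (s≤s (≤-trans (j≤start j) (m≤m+n _ _)))

  change⇒start : ∀ i → runWord i ≢ runWord (suc i) → ∃[ j ] suc i ≡ start j
  change⇒start i change with position-in-run (suc i)
  ... | j , zero  , _   , 1+i≡ = j , trans 1+i≡ (+-identityʳ (start j))
  ... | j , suc t , t<r , 1+i≡ =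
    ⊥-elim (change (trans same (sym (trans (cong runWord 1+i≡) (runWord-run j (suc t) t<r)))))
    where
    same : runWord i ≡ isOdd j
    same = trans (cong runWord (suc-injective (trans 1+i≡ (+-suc (start j) t)))) (runWord-run j t (<⇒≤ t<r))

  run-length-from-letters : ∀ j k → (∀ t → t < suc k → runWord (start j + t) ≡ isOdd j) →
                            runWord (start j + suc k) ≢ isOdd j → r j ≡ k
  run-length-from-letters j k inside leaves with <-cmp (r j) k
  ... | tri≈ _ r≡k _ = r≡k
  ... | tri< r<k _ _ = ⊥-elim (not-¬ refl (trans (sym (inside (suc (r j)) (s≤s r<k))) (runWord-start (suc j))))
  ... | tri> _ _ k<r = ⊥-elim (leaves (runWord-run j (suc k) k<r))

  run-length : ∀ j k c d y → d ≢ c → OccursAt runWord (replicate (suc k) c ++ (d ∷ y)) (start j) →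
               r j ≡ k × OccursAt runWord (d ∷ y) (start (suc j))
  run-length j k c d y d≢c occ =
    r≡k , subst (OccursAt runWord (d ∷ y)) (cong (λ n → start j + suc n) (sym r≡k)) occ-rest
    where
    split = occursAt-++⁻ runWord (replicate (suc k) c) (d ∷ y) occ
    inside : ∀ t → t < suc k → runWord (start j + t) ≡ c
    inside = occursAt-replicate⁻ runWord (suc k) c (proj₁ split)
    c≡ : c ≡ isOdd j
    c≡ = trans (sym (inside 0 (s≤s z≤n))) (runWord-run j 0 z≤n)
    occ-rest : OccursAt runWord (d ∷ y) (start j + suc k)
    occ-rest = subst (λ n → OccursAt runWord (d ∷ y) (start j + n)) (length-replicate (suc k)) (proj₂ split)
    r≡k : r j ≡ k
    r≡k = run-length-from-letters j k (λ t t<k → trans (inside t t<k) c≡)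
            (λ same → d≢c (trans (sym (occursAt-head runWord occ-rest)) (trans same (sym c≡))))

  sandwich⇒equal-runs : ∀ i c k m → OccursAt runWord (sandwich c k m) i →
                        ∃[ j ] r j ≡ k × r (suc (suc j)) ≡ k
  sandwich⇒equal-runs i c k m occ = j , proj₁ run₁ , proj₁ run₃
    where
    A = replicate (suc k) c
    B = replicate (suc m) (not c)
    inner : OccursAt runWord (A ++ (B ++ (A ∷ʳ not c))) (suc i)
    inner = subst (λ u → OccursAt runWord u (suc i))
                  (trans (++-assoc A (B ++ A) _) (cong (A ++_) (++-assoc B A _))) (occursAt-tail runWord occ)
    boundary : runWord i ≢ runWord (suc i)
    boundary same =
      not-¬ refl (trans (sym (occursAt-head runWord inner)) (trans (sym same) (occursAt-head runWord occ)))
    j = proj₁ (change⇒start i boundary)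
    not-c≢c : not c ≢ c
    not-c≢c e = not-¬ refl (sym e)
    run₁ = run-length j k c (not c) _ not-c≢c
             (subst (OccursAt runWord _) (proj₂ (change⇒start i boundary)) inner)
    run₂ = run-length (suc j) m (not c) c _ (not-¬ refl) (proj₂ run₁)
    run₃ = run-length (suc (suc j)) k c (not c) [] not-c≢c (proj₂ run₂)

  runWord-replicate : ∀ j n → n ≤ suc (r j) → OccursAt runWord (replicate n (isOdd j)) (start j)
  runWord-replicate j n n≤ =
    occursAt-replicate⁺ runWord n (isOdd j) λ t t<n → runWord-run j t (≤-pred (≤-trans t<n n≤))

  start-shift : ∀ K j → (∀ j′ → j′ < j → r (j′ + K) ≡ r j′) → start (j + K) ≡ start K + start j
  start-shift K zero    _        = sym (+-identityʳ (start K))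
  start-shift K (suc j) periodic = begin
    start (j + K) + suc (r (j + K))
      ≡⟨ cong₂ (λ a b → a + suc b) (start-shift K j periodic′) (periodic j ≤-refl) ⟩
    start K + start j + suc (r j)   ≡⟨ +-assoc (start K) (start j) (suc (r j)) ⟩
    start K + start (suc j)         ∎
    where
    open ≡-Reasoning
    periodic′ : ∀ j′ → j′ < j → r (j′ + K) ≡ r j′
    periodic′ j′ j′<j = periodic j′ (m<n⇒m<1+n j′<j)

  runWord-shift : ∀ K → isOdd K ≡ false → ∀ i → (∀ j → j ≤ i → r (j + K) ≡ r j) →
                  runWord (start K + i) ≡ runWord i
  runWord-shift K K-even i periodic with position-in-run i
  ... | j , t , t≤r , refl = begin
    runWord (start K + (start j + t)) ≡⟨ cong runWord (sym (+-assoc (start K) (start j) t)) ⟩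
    runWord (start K + start j + t)   ≡⟨ cong (λ n → runWord (n + t)) (sym (start-shift K j periodic′)) ⟩
    runWord (start (j + K) + t)       ≡⟨ runWord-run (j + K) t (subst (t ≤_) (sym (periodic j j≤i)) t≤r) ⟩
    isOdd (j + K)                     ≡⟨ isOdd-+-even j K-even ⟩
    isOdd j                           ≡⟨ sym (runWord-run j t t≤r) ⟩
    runWord (start j + t)             ∎
    where
    open ≡-Reasoning
    j≤i : j ≤ start j + t
    j≤i = ≤-trans (j≤start j) (m≤m+n (start j) t)
    periodic′ : ∀ j′ → j′ < j → r (j′ + K) ≡ r j′
    periodic′ j′ j′<j = periodic j′ (≤-trans (<⇒≤ j′<j) j≤i)

  runWord-aperiodic : (∀ p N → ∃[ j ] N ≤ j × r (suc j) ≡ p) → Aperiodic runWord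
  runWord-aperiodic lengths (suc p , N , _ , periodic) with lengths p N
  ... | j , N≤j , r≡p =
    not-¬ refl (trans (sym (runWord-run j (r j) ≤-refl)) (trans (sym (periodic i N≤i)) after))
    where
    i = start j + r j
    N≤i : N ≤ i
    N≤i = ≤-trans N≤j (≤-trans (j≤start j) (m≤m+n (start j) (r j)))
    i+1+p≡ : i + suc p ≡ start (suc j) + p
    i+1+p≡ = trans (+-suc i p) (cong (_+ p) (sym (+-suc (start j) (r j))))
    after : runWord (i + suc p) ≡ not (isOdd j)
    after = trans (cong runWord i+1+p≡) (runWord-run (suc j) p (≤-reflexive (sym r≡p)))

-- The ruler word

rulerRuns : ℕ → ℕ
rulerRuns j = ruler ⌊ j /2⌋

open RunWord rulerRuns

rulerWord : Word
rulerWord = runWord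

-- Pitfall: with-abstraction over goals mentioning rulerWord, and implicit positions of occurrences
-- in rulerWord, make Agda normalise rulerWord (and the binary arithmetic inside ruler) to the
-- point of exhausting memory.  Hence the lets and the explicit {i = …} below.

rulerRuns-even-suc : ∀ j → isOdd j ≡ false → rulerRuns (suc j) ≡ rulerRuns j
rulerRuns-even-suc j j-even with even-or-odd j
... | inj₁ (k , refl) = cong ruler (trans (sym (n≡⌈n+n/2⌉ k)) (n≡⌊n+n/2⌋ k))
... | inj₂ (k , refl) = ⊥-elim (true≢false (trans (sym (cong not (isOdd-double k))) j-even))

rulerWord-sandwichFree : ∀ i c k m → ¬ OccursAt rulerWord (sandwich c k m) i
rulerWord-sandwichFree i c k m occ =
  let j , r≡k , r₂≡k = sandwich⇒equal-runs i c k m occ in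
  ruler-suc-≢ ⌊ j /2⌋ (trans r≡k (sym r₂≡k))

rulerWord-prefixes-recur : ∀ n N → ∃[ s ] N ≤ s × (∀ i → i < n → rulerWord (s + i) ≡ rulerWord i)
rulerWord-prefixes-recur n N = start K , N≤start , λ i i<n → runWord-shift K (isOdd-double P) i (periodic i<n)
  where
  M = n + N
  P = 2 ^ M
  K = P + P
  N≤start : N ≤ start K
  N≤start = ≤-trans (m≤n+m N n) (≤-trans (<⇒≤ (n<2^n M)) (≤-trans (m≤m+n P P) (j≤start K)))
  periodic : ∀ {i} → i < n → ∀ j → j ≤ i → rulerRuns (j + K) ≡ rulerRuns j
  periodic i<n j j≤i = trans (cong ruler (⌊+double/2⌋ j P)) (ruler-periodic M ⌊ j /2⌋
    (≤-<-trans (≤-trans (s≤s (≤-trans (⌊n/2⌋≤n j) j≤i)) (≤-trans i<n (m≤m+n n N))) (n<2^n M)))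

rulerWord-aperiodic : Aperiodic rulerWord
rulerWord-aperiodic = runWord-aperiodic odd-run-attains
  where
  odd-run-attains : ∀ p N → ∃[ j ] N ≤ j × rulerRuns (suc j) ≡ p
  odd-run-attains p N =
    let x , N≤x , rx = ruler-attains p N in
    x + x , ≤-trans N≤x (m≤m+n x x) , trans (cong ruler (sym (n≡⌈n+n/2⌉ x))) rx

rulerWord-replicate : ∀ n → Factor rulerWord (replicate n false)
rulerWord-replicate n = start (x + x) ,
  subst (λ c → OccursAt rulerWord (replicate n c) (start (x + x))) (isOdd-double x)
        (runWord-replicate (x + x) n (≤-trans (n≤1+n n) (s≤s (≤-reflexive (sym run≡n)))))
  where
  x = proj₁ (ruler-attains n 0)
  run≡n : rulerRuns (x + x) ≡ n
  run≡n = trans (cong ruler (sym (n≡⌊n+n/2⌋ x))) (proj₂ (proj₂ (ruler-attains n 0)))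

rulerWord-new-palindrome : (L : List (List Bool)) → ∃[ u ] (Factor rulerWord u × Palindrome u × ¬ (u ∈ L))
rulerWord-new-palindrome L = replicate n false , rulerWord-replicate n , reverse-replicate n false , too-long
  where
  n = suc (sum (map length L))
  too-long : ¬ (replicate n false ∈ L)
  too-long u∈L = <-irrefl refl (subst (_≤ sum (map length L)) (length-replicate n) (∈⇒length≤ L u∈L))

rulerWord-no-10010 : ∀ i → ¬ OccursAt rulerWord (true ∷ false ∷ false ∷ true ∷ false ∷ []) i
rulerWord-no-10010 i occ =
  1≢0 (trans (sym (proj₁ run₁)) (trans (sym (rulerRuns-even-suc j j-even)) (proj₁ run₂)))
  where
  1≢0 : 1 ≢ 0
  1≢0 ()
  tail : OccursAt rulerWord (false ∷ false ∷ true ∷ false ∷ []) (suc i)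
  tail = occursAt-tail rulerWord {i = i} occ
  boundary : rulerWord i ≢ rulerWord (suc i)
  boundary same = true≢false
    (trans (sym (occursAt-head rulerWord {i = i} occ)) (trans same (occursAt-head rulerWord {i = suc i} tail)))
  j = proj₁ (change⇒start i boundary)
  occ₁ : OccursAt rulerWord (replicate 2 false ++ (true ∷ false ∷ [])) (start j)
  occ₁ = subst (OccursAt rulerWord _) (proj₂ (change⇒start i boundary)) tail
  j-even : isOdd j ≡ false
  j-even = trans (sym (runWord-start j)) (occursAt-head rulerWord {i = start j} occ₁)
  run₁ = run-length j 1 false true (false ∷ []) (λ ()) occ₁
  run₂ = run-length (suc j) 0 true false [] (λ ()) (proj₂ run₁)

rulerWord-not-closed : ¬ ClosedUnderReversal rulerWord
rulerWord-not-closed closed =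
  let i , occ = closed (false ∷ true ∷ false ∷ false ∷ true ∷ []) (0 , refl) in rulerWord-no-10010 i occ

rulerWord-privileged-non-palindrome : ∃[ u ] (Factor rulerWord u × Privileged u × ¬ Palindrome u)
rulerWord-privileged-non-palindrome = u , (2 , refl) , u-privileged , λ ()
  where
  u : List Bool
  u = false ∷ false ∷ true ∷ true ∷ false ∷ true ∷ false ∷ false ∷ []
  u-privileged : Privileged u
  u-privileged = priv-return u (false ∷ false ∷ []) (s≤s (s≤s (s≤s z≤n))) (replicate-privileged 2 false)
    ( (true ∷ true ∷ false ∷ true ∷ false ∷ false ∷ [] , refl)
    , (false ∷ false ∷ true ∷ true ∷ false ∷ true ∷ [] , refl)
    , refl )

lemma3p5 : ∃[ w ] (Recurrent w × Aperiodic w × ¬ ClosedUnderReversal w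
    × ((L : List (List Bool)) → ∃[ u ] (Factor w u × Palindrome u × ¬ (u ∈ L)))
    × ((u : List Bool) → Factor w u → Palindrome u → Privileged u)
    × ∃[ u ] (Factor w u × Privileged u × ¬ Palindrome u))
lemma3p5 =
  rulerWord ,
  prefixes-recur⇒recurrent rulerWord rulerWord-prefixes-recur ,
  rulerWord-aperiodic ,
  rulerWord-not-closed ,
  rulerWord-new-palindrome ,
  palindromic-factors-privileged rulerWord rulerWord-sandwichFree ,
  rulerWord-privileged-non-palindrome
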